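{- For the $k$-server problem on the line and on the circle, a configuration $C^*$ in which the servers are spaced uniformly is a best configuration: for every configuration $C$ and every index $i$, $D^{\min}_{C^*}(\mathcal{P}^\delta_{C^*}[i])\le D^{\min}_{C}(\mathcal{P}^\delta_{C}[i])$.
   Context: The line $[0,1]$ (resp. the circle of circumference 1, with an arbitrary point chosen as $0$) is discretized into equally spaced points at distance $\delta>0$, with $\delta$ chosen so that the points at positions $i/(2k)$, $i=0,\dots,2k$, are among them. A configuration $C$ is a placement of $k$ servers on these points. For a point $p$, $D^{\min}_C(p)$ is the distance from $p$ to the nearest server of $C$. $\mathcal{P}^\delta_C$ is the sequence of all points of the discretized metric ordered by nondecreasing $D^{\min}_C$ (ties broken arbitrarily), and $\mathcal{P}^\delta_C[i]$ its $i$-th element. The servers are spaced uniformly if there is a server at position $i/(2k)$ for every odd $i\in[0,2k]$. -}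

module Defs where

open import Data.Nat using (ℕ; zero; suc; _+_; _*_; _∸_; _⊓_; _≤_; ∣_-_∣)
open import Data.Fin using (Fin; toℕ) renaming (_≤_ to _≤ᶠ_)
open import Data.Fin.Permutation using (Permutation′; _⟨$⟩ʳ_)
open import Data.Vec using (Vec; foldr₁; map)
open import Data.Vec.Relation.Unary.Any using (Any)
open import Relation.Binary.PropositionalEquality using (_≡_)

-- Discretization in units of δ: the grid has N = 2·k·m intervals of length δ,
-- i.e. δ = 1/(2km), so that positions i/(2k) are grid points (index i·m).
data Space : Set where
  line circle : Space

numPoints : Space → ℕ → ℕ
numPoints line   N = suc N
numPoints circle N = N

dist : Space → ℕ → ℕ → ℕ → ℕ
dist line   N a b = ∣ a - b ∣
dist circle N a b = ∣ a - b ∣ ⊓ (N ∸ ∣ a - b ∣)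

Config : Space → ℕ → ℕ → Set
Config S N k = Vec (Fin (numPoints S N)) (suc k)

Dmin : (S : Space) (N k : ℕ) → Config S N k → Fin (numPoints S N) → ℕ
Dmin S N k C p = foldr₁ _⊓_ (map (λ s → dist S N (toℕ p) (toℕ s)) C)

-- π is an ordering P_C of all points by nondecreasing D^min_C (ties arbitrary)
IsOrdering : (S : Space) (N k : ℕ) → Config S N k → Permutation′ (numPoints S N) → Set
IsOrdering S N k C π =
  ∀ i j → i ≤ᶠ j → Dmin S N k C (π ⟨$⟩ʳ i) ≤ Dmin S N k C (π ⟨$⟩ʳ j)

-- uniform spacing, with K = suc k servers and grid unit so that 1/(2K) = m points:
-- for every odd i = 2j+1 < 2K there is a server at position i/(2K), i.e. index (2j+1)·m
Uniform : (S : Space) (k m : ℕ) → Config S (2 * suc k * m) k → Set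
Uniform S k m C = ∀ (j : Fin (suc k)) → Any (λ s → toℕ s ≡ (2 * toℕ j + 1) * m) C

module Submission where

-- Let d = D_C(P_C[i]). Every point within distance d of a server of C is determined by
-- that server and its offset in a window of 2d + 1 points, so the i + 1 points of rank
-- ≤ i give i + 1 ≤ K(2d + 1). If the uniform spacing M (half the gap between servers)
-- exceeds d, the K windows of radius d around the uniform servers are disjoint, so
-- K(2d + 1) points have D_{C*} ≤ d; were D_{C*}(P_{C*}[i]) > d, they would all have
-- rank < i, contradicting the first bound. If d ≥ M nothing is left to prove: every
-- point lies within M of a uniform server.

open import Defs

open import Data.Empty using (⊥-elim)
open import Data.Fin using (Fin; toℕ; fromℕ<; inject≤; combine; remQuot)
  renaming (_≤_ to _≤ᶠ_; zero to fzero; suc to fsuc)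
open import Data.Fin.Permutation using (Permutation′; _⟨$⟩ʳ_; _⟨$⟩ˡ_; inverseʳ; flip)
open import Data.Fin.Properties
  using (toℕ<n; toℕ-fromℕ<; toℕ-injective; fromℕ<-injective; toℕ-inject≤; inject≤-injective;
         combine-injective; toℕ-combine; *↔×; injective⇒≤)
open import Data.List using ([]; _∷_)
open import Data.Nat
  using (ℕ; zero; suc; _+_; _*_; _∸_; _⊓_; _≤_; _<_; ∣_-_∣; z≤n; s≤s; s≤s⁻¹; _≤?_; NonZero; >-nonZero)
open import Data.Nat.DivMod using (_%_; [m+kn]%n≡m%n; m<n⇒m%n≡m)
open import Data.Nat.Properties
open import Data.Nat.Tactic.RingSolver using (solve)
open import Data.Product using (∃₂; ∃-syntax; _×_; _,_)
open import Data.Product.Properties using (×-≡,≡→≡)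
open import Data.Sum using (inj₁; inj₂)
open import Data.Vec using (Vec; foldr₁; map; lookup)
open import Data.Vec.Relation.Unary.Any using (Any; here; there)
import Data.Vec.Relation.Unary.Any as Any
open import Data.Vec.Relation.Unary.Any.Properties using (lookup-index)
open import Function using (_∘_)
open import Function.Bundles using (Injection)
open import Function.Definitions using (Injective)
open import Function.Properties.Inverse using (↔⇒↣)
open import Relation.Binary.PropositionalEquality
open import Relation.Nullary using (yes; no; contradiction)

∣-∣≤⇒offset : ∀ {x y d} → ∣ x - y ∣ ≤ d → ∃[ o ] o ≤ d + d × x + d ≡ y + o
∣-∣≤⇒offset {x} {y} {d} ∣x-y∣≤d with ≤-total x y
... | inj₁ x≤y
  with e , refl ← m≤n⇒∃[o]m+o≡n x≤y
  with f , refl ← m≤n⇒∃[o]m+o≡n (subst (_≤ d) (∣m-m+n∣≡n x e) ∣x-y∣≤d)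
  = f , ≤-trans (m≤n+m f e) (m≤m+n d d) , sym (+-assoc x e f)
... | inj₂ y≤x
  with e , refl ← m≤n⇒∃[o]m+o≡n y≤x
  = e + d , +-monoˡ-≤ d e≤d , +-assoc y e d
  where
  e≤d : e ≤ d
  e≤d = subst (_≤ d) (trans (∣-∣-comm (y + e) y) (∣m-m+n∣≡n y e)) ∣x-y∣≤d

∣m-n∣≤n : ∀ {m n} → m ≤ n + n → ∣ m - n ∣ ≤ n
∣m-n∣≤n {m} {n} m≤2n with ≤-total m n
... | inj₁ m≤n rewrite m≤n⇒∣m-n∣≡n∸m m≤n = m∸n≤m n m
... | inj₂ n≤m rewrite m≤n⇒∣n-m∣≡n∸m n≤m = m≤n+o⇒m∸n≤o m n m≤2n

offset⇒∣-∣≤ : ∀ {x y d o} → x + d ≡ y + o → o ≤ d + d → ∣ x - y ∣ ≤ d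
offset⇒∣-∣≤ {x} {y} {d} {o} x+d≡y+o o≤2d = subst (_≤ d) ∣o-d∣≡∣x-y∣ (∣m-n∣≤n o≤2d)
  where
  open ≡-Reasoning
  ∣o-d∣≡∣x-y∣ : ∣ o - d ∣ ≡ ∣ x - y ∣
  ∣o-d∣≡∣x-y∣ = begin
    ∣ o - d ∣             ≡⟨ ∣m+n-m+o∣≡∣n-o∣ y o d ⟨
    ∣ y + o - y + d ∣     ≡⟨ cong (λ z → ∣ z - y + d ∣) x+d≡y+o ⟨
    ∣ x + d - y + d ∣     ≡⟨ cong₂ ∣_-_∣ (+-comm x d) (+-comm y d) ⟩
    ∣ d + x - d + y ∣     ≡⟨ ∣m+n-m+o∣≡∣n-o∣ d x y ⟩
    ∣ x - y ∣             ∎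

∣n+p-s∣≡n∸∣p-s∣ : ∀ {n p s} → p ≤ s → s ≤ n → ∣ n + p - s ∣ ≡ n ∸ ∣ p - s ∣
∣n+p-s∣≡n∸∣p-s∣ {n} {p} p≤s s≤n with e , refl ← m≤n⇒∃[o]m+o≡n p≤s = begin
    ∣ n + p - p + e ∣     ≡⟨ cong (λ z → ∣ z - p + e ∣) (+-comm n p) ⟩
    ∣ p + n - p + e ∣     ≡⟨ ∣m+n-m+o∣≡∣n-o∣ p n e ⟩
    ∣ n - e ∣             ≡⟨ m≤n⇒∣n-m∣≡n∸m (≤-trans (m≤n+m e p) s≤n) ⟩
    n ∸ e                 ≡⟨ cong (n ∸_) (∣m-m+n∣≡n p e) ⟨
    n ∸ ∣ p - p + e ∣     ∎
  where open ≡-Reasoning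

∣p-n+s∣≡n∸∣p-s∣ : ∀ {n p s} → s ≤ p → p ≤ n → ∣ p - n + s ∣ ≡ n ∸ ∣ p - s ∣
∣p-n+s∣≡n∸∣p-s∣ {n} {p} {s} s≤p p≤n = begin
  ∣ p - n + s ∣      ≡⟨ ∣-∣-comm p (n + s) ⟩
  ∣ n + s - p ∣      ≡⟨ ∣n+p-s∣≡n∸∣p-s∣ s≤p p≤n ⟩
  n ∸ ∣ s - p ∣      ≡⟨ cong (n ∸_) (∣-∣-comm s p) ⟩
  n ∸ ∣ p - s ∣      ∎
  where open ≡-Reasoning

-- p is the o-th point of the window [s − d, s + d], after shifting p and s by multiples of n
AtOffset : (n d p s o : ℕ) → Set
AtOffset n d p s o = ∃₂ λ a b → a * n + p + d ≡ b * n + s + o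

AtOffset-unique : ∀ {n d p q s o} → p < n → q < n →
  AtOffset n d p s o → AtOffset n d q s o → p ≡ q
AtOffset-unique {n} {d} {p} {q} {s} {o} p<n q<n (a , b , eqp) (a′ , b′ , eqq) = begin
  p                       ≡⟨ m<n⇒m%n≡m p<n ⟨
  p % n                   ≡⟨ [m+kn]%n≡m%n p (a + b′) n ⟨
  (p + (a + b′) * n) % n  ≡⟨ cong (_% n) lifts-equal ⟩
  (q + (a′ + b) * n) % n  ≡⟨ [m+kn]%n≡m%n q (a′ + b) n ⟩
  q % n                   ≡⟨ m<n⇒m%n≡m q<n ⟩
  q                       ∎
  where
  open ≡-Reasoning
  instance _ : NonZero n
  _ = >-nonZero (≤-<-trans z≤n p<n)
  lifts-equal : p + (a + b′) * n ≡ q + (a′ + b) * n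
  lifts-equal = +-cancelʳ-≡ d _ _ (begin
    p + (a + b′) * n + d         ≡⟨ solve (p ∷ a ∷ b′ ∷ n ∷ d ∷ []) ⟩
    (a * n + p + d) + b′ * n     ≡⟨ cong (_+ b′ * n) eqp ⟩
    (b * n + s + o) + b′ * n     ≡⟨ solve (b ∷ n ∷ s ∷ o ∷ b′ ∷ []) ⟩
    (b′ * n + s + o) + b * n     ≡⟨ cong (_+ b * n) eqq ⟨
    (a′ * n + q + d) + b * n     ≡⟨ solve (a′ ∷ n ∷ q ∷ d ∷ b ∷ []) ⟩
    q + (a′ + b) * n + d         ∎)

∣-∣≤⇒AtOffset : ∀ {n p s d} → ∣ p - s ∣ ≤ d → ∃[ o ] o ≤ d + d × AtOffset n d p s o
∣-∣≤⇒AtOffset h with o , o≤2d , p+d≡s+o ← ∣-∣≤⇒offset h = o , o≤2d , 0 , 0 , p+d≡s+o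

dist≤⇒AtOffset : ∀ S {N p s d} → p < numPoints S N → s < numPoints S N → dist S N p s ≤ d →
  ∃[ o ] o ≤ d + d × AtOffset (numPoints S N) d p s o
dist≤⇒AtOffset line _ _ h = ∣-∣≤⇒AtOffset h
dist≤⇒AtOffset circle {N} {p} {s} {d} p<N s<N h with ⊓-sel ∣ p - s ∣ (N ∸ ∣ p - s ∣)
... | inj₁ eq = ∣-∣≤⇒AtOffset (subst (_≤ d) eq h)
... | inj₂ eq with ≤-total p s
  -- the wrap-around distance is the plain distance once the smaller of p, s is lifted by N
...   | inj₁ p≤s
  with o , o≤2d , N+p+d≡s+o ← ∣-∣≤⇒offset (subst (_≤ d) (trans eq (sym (∣n+p-s∣≡n∸∣p-s∣ p≤s (<⇒≤ s<N)))) h)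
  = o , o≤2d , 1 , 0 , subst (λ z → z + p + d ≡ s + o) (sym (+-identityʳ N)) N+p+d≡s+o
...   | inj₂ s≤p
  with o , o≤2d , p+d≡N+s+o ← ∣-∣≤⇒offset (subst (_≤ d) (trans eq (sym (∣p-n+s∣≡n∸∣p-s∣ s≤p (<⇒≤ p<N)))) h)
  = o , o≤2d , 0 , 1 , subst (λ z → p + d ≡ z + s + o) (sym (+-identityʳ N)) p+d≡N+s+o

-- Vector constructors are kept local: next to the list constructors they make the ring
-- solver's variable lists ambiguous, which makes elaboration blow up.
module _ {A : Set} where
  open import Data.Vec using ([]; _∷_)

  foldr₁-⊓≤⇒Any : ∀ {n d} (f : A → ℕ) (xs : Vec A (suc n)) →
    foldr₁ _⊓_ (map f xs) ≤ d → Any (λ x → f x ≤ d) xs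
  foldr₁-⊓≤⇒Any f (x ∷ []) h = here h
  foldr₁-⊓≤⇒Any f (x ∷ y ∷ ys) h with ⊓-sel (f x) (foldr₁ _⊓_ (map f (y ∷ ys)))
  ... | inj₁ eq = here (subst (_≤ _) eq h)
  ... | inj₂ eq = there (foldr₁-⊓≤⇒Any f (y ∷ ys) (subst (_≤ _) eq h))

  Any⇒foldr₁-⊓≤ : ∀ {n d} (f : A → ℕ) (xs : Vec A (suc n)) →
    Any (λ x → f x ≤ d) xs → foldr₁ _⊓_ (map f xs) ≤ d
  Any⇒foldr₁-⊓≤ f (x ∷ []) (here h) = h
  Any⇒foldr₁-⊓≤ f (x ∷ y ∷ ys) (here h) = ≤-trans (m⊓n≤m _ _) h
  Any⇒foldr₁-⊓≤ f (x ∷ y ∷ ys) (there h) = ≤-trans (m⊓n≤n (f x) _) (Any⇒foldr₁-⊓≤ f (y ∷ ys) h)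

module _ {n} (D : Fin n → ℕ) (π : Permutation′ n)
         (sorted : ∀ i j → i ≤ᶠ j → D (π ⟨$⟩ʳ i) ≤ D (π ⟨$⟩ʳ j)) where

  rank<code-size : ∀ {a d} (i : Fin n) (code : (p : Fin n) → D p ≤ d → Fin a) →
    (∀ {p q} (hp : D p ≤ d) (hq : D q ≤ d) → code p hp ≡ code q hq → p ≡ q) →
    D (π ⟨$⟩ʳ i) ≤ d → toℕ i < a
  rank<code-size {d = d} i code code-injective Dπi≤d =
    injective⇒≤ {f = λ j → code (ranked j) (ranked≤d j)}
      (inject≤-injective _ _ _ _ ∘ Injection.injective (↔⇒↣ π) ∘ code-injective _ _)
    where
    ranked : Fin (suc (toℕ i)) → Fin n
    ranked j = π ⟨$⟩ʳ inject≤ j (toℕ<n i)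
    ranked≤d : ∀ j → D (ranked j) ≤ d
    ranked≤d j = ≤-trans (sorted _ i (subst (_≤ toℕ i) (sym (toℕ-inject≤ j _)) (s≤s⁻¹ (toℕ<n j)))) Dπi≤d

  injection-size≤rank : ∀ {a d} (i : Fin n) (f : Fin a → Fin n) → Injective _≡_ _≡_ f →
    (∀ x → D (f x) ≤ d) → d < D (π ⟨$⟩ʳ i) → a ≤ toℕ i
  injection-size≤rank {d = d} i f f-injective Df≤d d<Dπi =
    injective⇒≤ {f = λ x → fromℕ< (rank<i x)}
      (f-injective ∘ Injection.injective (↔⇒↣ (flip π)) ∘ toℕ-injective ∘ fromℕ<-injective _ _ _ _)
    where
    rank<i : ∀ x → toℕ (π ⟨$⟩ˡ f x) < toℕ i
    rank<i x = ≰⇒> λ i≤ → <⇒≱ d<Dπi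
      (≤-trans (sorted i _ i≤) (subst (λ p → D p ≤ d) (sym (inverseʳ π)) (Df≤d x)))

dist≤∣-∣ : ∀ S N a b → dist S N a b ≤ ∣ a - b ∣
dist≤∣-∣ line   N a b = ≤-refl
dist≤∣-∣ circle N a b = m⊓n≤m _ _

module _ (S : Space) (N k : ℕ) (C : Config S N k) (d : ℕ) where

  record BallPosition (p : Fin (numPoints S N)) : Set where
    field
      centre   : Fin (suc k)
      offset   : Fin (suc (d + d))
      atOffset : AtOffset (numPoints S N) d (toℕ p) (toℕ (lookup C centre)) (toℕ offset)

  open BallPosition

  ballPosition : ∀ p → Dmin S N k C p ≤ d → BallPosition p
  ballPosition p Dp≤d = fromNearServer (foldr₁-⊓≤⇒Any _ C Dp≤d)
    where
    fromNearServer : Any (λ s → dist S N (toℕ p) (toℕ s) ≤ d) C → BallPosition p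
    fromNearServer near
      with o , o≤2d , at ← dist≤⇒AtOffset S (toℕ<n p) (toℕ<n (Any.lookup near)) (lookup-index near)
      = record
        { centre   = Any.index near
        ; offset   = fromℕ< (s≤s o≤2d)
        ; atOffset = subst (AtOffset _ d _ _) (sym (toℕ-fromℕ< (s≤s o≤2d))) at
        }

  BallPosition-unique : ∀ {p q} (x : BallPosition p) (y : BallPosition q) →
    centre x ≡ centre y → offset x ≡ offset y → p ≡ q
  BallPosition-unique {p} {q} x y c≡ o≡ = toℕ-injective
    (AtOffset-unique (toℕ<n p) (toℕ<n q) (atOffset x)
      (subst₂ (λ c o → AtOffset _ d (toℕ q) (toℕ (lookup C c)) (toℕ o)) (sym c≡) (sym o≡) (atOffset y)))

  ballCode : ∀ p → Dmin S N k C p ≤ d → Fin (suc k * suc (d + d))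
  ballCode p Dp≤d = combine (centre b) (offset b)
    where b = ballPosition p Dp≤d

  ballCode-injective : ∀ {p q} (hp : Dmin S N k C p ≤ d) (hq : Dmin S N k C q ≤ d) →
    ballCode p hp ≡ ballCode q hq → p ≡ q
  ballCode-injective hp hq eq =
    let c≡ , o≡ = combine-injective _ _ _ _ eq in
    BallPosition-unique (ballPosition _ hp) (ballPosition _ hq) c≡ o≡

N≤numPoints : ∀ S N → N ≤ numPoints S N
N≤numPoints line   N = n≤1+n N
N≤numPoints circle N = ≤-refl

toℕ≤N : ∀ S N (p : Fin (numPoints S N)) → toℕ p ≤ N
toℕ≤N line   N p = s≤s⁻¹ (toℕ<n p)
toℕ≤N circle N p = <⇒≤ (toℕ<n p)

decompose-≤* : ∀ K L {p} → p ≤ suc K * L → ∃₂ λ (t : Fin (suc K)) r → r ≤ L × p ≡ L * toℕ t + r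
decompose-≤* K L {p} p≤ with p ≤? L
... | yes p≤L = fzero , p , p≤L , cong (_+ p) (sym (*-zeroʳ L))
decompose-≤* zero L {p} p≤ | no p≰L = ⊥-elim (p≰L (subst (p ≤_) (+-identityʳ L) p≤))
decompose-≤* (suc K) L {p} p≤ | no p≰L
  with q , refl ← m≤n⇒∃[o]m+o≡n (<⇒≤ (≰⇒> p≰L))
  with t , r , r≤L , q≡ ← decompose-≤* K L (+-cancelˡ-≤ L _ _ p≤)
  = fsuc t , r , r≤L , (begin
    L + q                 ≡⟨ cong (L +_) q≡ ⟩
    L + (L * toℕ t + r)   ≡⟨ +-assoc L _ r ⟨
    L + L * toℕ t + r     ≡⟨ cong (_+ r) (*-suc L (toℕ t)) ⟨
    L * suc (toℕ t) + r   ∎)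
  where open ≡-Reasoning

centred-window : ∀ {M d} t o → d ≤ M → (M + M) * t + (M ∸ d + o) + d ≡ (2 * t + 1) * M + o
centred-window {M} {d} t o d≤M with M ∸ d | m∸n+n≡m d≤M
... | c | refl = solve (c ∷ d ∷ t ∷ o ∷ [])

window<double : ∀ {M d o} → d < M → o ≤ d + d → M ∸ d + o < M + M
window<double {M} {d} {o} d<M o≤2d = begin-strict
  M ∸ d + o          ≤⟨ +-monoʳ-≤ (M ∸ d) o≤2d ⟩
  M ∸ d + (d + d)    ≡⟨ +-assoc (M ∸ d) d d ⟨
  M ∸ d + d + d      ≡⟨ cong (_+ d) (m∸n+n≡m (<⇒≤ d<M)) ⟩
  M + d              <⟨ +-monoʳ-< M d<M ⟩
  M + M              ∎
  where open ≤-Reasoning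

2*m*n≡m*[n+n] : ∀ m n → 2 * m * n ≡ m * (n + n)
2*m*n≡m*[n+n] m n = solve (m ∷ n ∷ [])

module _ {S : Space} {k M : ℕ} {Cs : Config S (2 * suc k * M) k} (uniform : Uniform S k M Cs) where

  uniform-near : ∀ p t {e o} → toℕ p + e ≡ (2 * toℕ t + 1) * M + o → o ≤ e + e →
    Dmin S (2 * suc k * M) k Cs p ≤ e
  uniform-near p t {e} {o} p+e≡ o≤2e = Any⇒foldr₁-⊓≤ _ Cs (Any.map near (uniform t))
    where
    near : ∀ {s} → toℕ s ≡ (2 * toℕ t + 1) * M → dist S (2 * suc k * M) (toℕ p) (toℕ s) ≤ e
    near s≡ = ≤-trans (dist≤∣-∣ S _ _ _) (offset⇒∣-∣≤ (trans p+e≡ (cong (_+ o) (sym s≡))) o≤2e)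

  uniform-covering : ∀ p → Dmin S (2 * suc k * M) k Cs p ≤ M
  uniform-covering p
    with t , r , r≤2M , p≡ ← decompose-≤* k (M + M)
           (subst (toℕ p ≤_) (2*m*n≡m*[n+n] (suc k) M) (toℕ≤N S _ p))
    = uniform-near p t (trans (cong (_+ M) p≡) (block-centre (toℕ t) r)) r≤2M
    where
    block-centre : ∀ t r → (M + M) * t + r + M ≡ (2 * t + 1) * M + r
    block-centre t r = solve (M ∷ t ∷ r ∷ [])

  module _ {d} (d<M : d < M) where

    -- the o-th point of the window of radius d around the server at (2t + 1)M
    uniformBall : Fin (suc k) × Fin (suc (d + d)) → Fin (numPoints S (2 * suc k * M))
    uniformBall (t , o) = inject≤ (combine t (fromℕ< (window<double d<M (s≤s⁻¹ (toℕ<n o)))))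
      (≤-trans (≤-reflexive (sym (2*m*n≡m*[n+n] (suc k) M))) (N≤numPoints S _))

    toℕ-uniformBall : ∀ t o → toℕ (uniformBall (t , o)) ≡ (M + M) * toℕ t + (M ∸ d + toℕ o)
    toℕ-uniformBall t o = begin
      toℕ (uniformBall (t , o))                 ≡⟨ toℕ-inject≤ _ _ ⟩
      toℕ (combine t (fromℕ< _))                ≡⟨ toℕ-combine t _ ⟩
      (M + M) * toℕ t + toℕ (fromℕ< _)          ≡⟨ cong ((M + M) * toℕ t +_) (toℕ-fromℕ< _) ⟩
      (M + M) * toℕ t + (M ∸ d + toℕ o)         ∎
      where open ≡-Reasoning

    uniformBall-near : ∀ x → Dmin S (2 * suc k * M) k Cs (uniformBall x) ≤ d
    uniformBall-near (t , o) = uniform-near _ t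
      (trans (cong (_+ d) (toℕ-uniformBall t o)) (centred-window (toℕ t) (toℕ o) (<⇒≤ d<M)))
      (s≤s⁻¹ (toℕ<n o))

    uniformBall-injective : Injective _≡_ _≡_ uniformBall
    uniformBall-injective {t , o} {t′ , o′} eq =
      let t≡t′ , r≡r′ = combine-injective _ _ _ _ (inject≤-injective _ _ _ _ eq) in
      ×-≡,≡→≡ (t≡t′ , toℕ-injective (+-cancelˡ-≡ (M ∸ d) _ _ (fromℕ<-injective _ _ _ _ r≡r′)))

module _ {S : Space} {k M : ℕ} {Cs : Config S (2 * suc k * M) k}
         (uniform : Uniform S k M Cs)
         (πs : Permutation′ (numPoints S (2 * suc k * M)))
         (sortedCs : IsOrdering S (2 * suc k * M) k Cs πs)
         (C : Config S (2 * suc k * M) k)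
         (π : Permutation′ (numPoints S (2 * suc k * M)))
         (sortedC : IsOrdering S (2 * suc k * M) k C π) where

  uniform-optimal-below-spacing : ∀ {d} i → d < M → Dmin S (2 * suc k * M) k C (π ⟨$⟩ʳ i) ≤ d →
    Dmin S (2 * suc k * M) k Cs (πs ⟨$⟩ʳ i) ≤ d
  uniform-optimal-below-spacing {d} i d<M Dπi≤d with Dmin S (2 * suc k * M) k Cs (πs ⟨$⟩ʳ i) ≤? d
  ... | yes Dπsi≤d = Dπsi≤d
  ... | no  Dπsi≰d = contradiction (<-≤-trans i<ballSize ballSize≤i) (n≮n (toℕ i))
    where
    i<ballSize : toℕ i < suc k * suc (d + d)
    i<ballSize = rank<code-size (Dmin S _ k C) π sortedC i
      (ballCode S _ k C d) (ballCode-injective S _ k C d) Dπi≤d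

    ballSize≤i : suc k * suc (d + d) ≤ toℕ i
    ballSize≤i = injection-size≤rank (Dmin S _ k Cs) πs sortedCs i
      (uniformBall uniform d<M ∘ remQuot (suc (d + d)))
      (Injection.injective (↔⇒↣ *↔×) ∘ uniformBall-injective uniform d<M)
      (uniformBall-near uniform d<M ∘ remQuot (suc (d + d)))
      (≰⇒> Dπsi≰d)

lemma6 : (S : Space) (k m : ℕ) →
    (Cs : Config S (2 * suc k * suc m) k) → Uniform S k (suc m) Cs →
    (C : Config S (2 * suc k * suc m) k) →
    (πs : Permutation′ (numPoints S (2 * suc k * suc m))) → IsOrdering S (2 * suc k * suc m) k Cs πs →
    (π : Permutation′ (numPoints S (2 * suc k * suc m))) → IsOrdering S (2 * suc k * suc m) k C π →
    (i : Fin (numPoints S (2 * suc k * suc m))) →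
    Dmin S (2 * suc k * suc m) k Cs (πs ⟨$⟩ʳ i) ≤ Dmin S (2 * suc k * suc m) k C (π ⟨$⟩ʳ i)
lemma6 S k m Cs uniform C πs sortedCs π sortedC i
  with suc m ≤? Dmin S (2 * suc k * suc m) k C (π ⟨$⟩ʳ i)
... | yes M≤d = ≤-trans (uniform-covering uniform (πs ⟨$⟩ʳ i)) M≤d
... | no M≰d = uniform-optimal-below-spacing uniform πs sortedCs C π sortedC i (≰⇒> M≰d) ≤-refl
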